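{- For all integers $n\geq 0$ and $k\geq 1$, \[ C_k(n+1)=\sum_{i=0}^n\binom{n}{i} E_k(i), \] where $C_k(m)$ denotes the number of set partitions of $[m]=\{1,\ldots,m\}$ with no classical $k$-crossing, and $E_k(m)$ denotes the number of set partitions of $[m]$ with no enhanced $k$-crossing.
   Context: Let $\pi$ be a set partition of a finite totally ordered set. A pair $a<b$ is said to appear consecutively in a block of $\pi$ if $a$ and $b$ lie in the same block and there is no element $x$ of that block with $a<x<b$. An enhanced $k$-crossing of $\pi$ is a sequence $a_1<a_2<\cdots<a_k\leq b_1<b_2<\cdots<b_k$ such that for each $i$, the pair $a_i<b_i$ appears consecutively in a block of $\pi$ (when $a_k=b_1$, the pair $a_k<b_k$ and $a_1<b_1$ still must be distinct consecutive pairs as described; for $k=1$ an enhanced $1$-crossing is interpreted as a pair $a_1\le b_1$ with either $a_1<b_1$ consecutive in a block, or $a_1=b_1$ a singleton block). A classical $k$-crossing is an enhanced $k$-crossing which additionally satisfies $a_k<b_1$. By convention $[0]=\emptyset$ and $C_k(0)=E_k(0)=1$ for the empty partition. -}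

module Defs where

open import Data.Nat using (ℕ)
open import Data.Fin using (Fin; _<_; _≤_)
open import Data.Vec using (Vec; lookup)
open import Data.Product using (_×_; Σ; ∃)
open import Data.Sum using (_⊎_)
open import Data.Empty using (⊥)
open import Relation.Nullary using (¬_)
open import Relation.Binary.PropositionalEquality using (_≡_)

-- A set partition of [m] = {0,…,m-1} (0-indexed, same total order as {1,…,m})
-- is encoded by the map sending each element to the least element of its block.
-- Such maps r : Vec (Fin m) m are exactly those with r(i) ≤ i and r(r(i)) = r(i);
-- this is a bijection with set partitions of [m]; the blocks are the fibres of r.
record SetPartition (m : ℕ) : Set where
  constructor mkPartition
  field
    rep     : Vec (Fin m) m
    .rep≤   : ∀ i → lookup rep i ≤ i
    .repIdem : ∀ i → lookup rep (lookup rep i) ≡ lookup rep i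

open SetPartition public

SameBlock : ∀ {m} → SetPartition m → Fin m → Fin m → Set
SameBlock π a b = lookup (rep π) a ≡ lookup (rep π) b

Consecutive : ∀ {m} → SetPartition m → Fin m → Fin m → Set
Consecutive π a b =
  a < b × SameBlock π a b × (∀ x → a < x → x < b → ¬ SameBlock π a x)

Singleton : ∀ {m} → SetPartition m → Fin m → Set
Singleton π a = ∀ x → SameBlock π a x → x ≡ a

StrictlyIncreasing : ∀ {k m} → (Fin k → Fin m) → Set
StrictlyIncreasing {k} f = ∀ (i j : Fin k) → i < j → f i < f j

-- The condition a_k ≤ b₁ is written as ∀ i j, aᵢ ≤ bⱼ (equivalent given monotonicity,
-- and meaningful uniformly in k).
EnhancedCrossing : ∀ {m} → ℕ → SetPartition m → Set
EnhancedCrossing {m} k π =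
  Σ (Fin k → Fin m) λ a → Σ (Fin k → Fin m) λ b →
    StrictlyIncreasing a × StrictlyIncreasing b ×
    (∀ i j → a i ≤ b j) ×
    (∀ i → Consecutive π (a i) (b i) ⊎ (a i ≡ b i × Singleton π (a i)))

ClassicalCrossing : ∀ {m} → ℕ → SetPartition m → Set
ClassicalCrossing {m} k π =
  Σ (Fin k → Fin m) λ a → Σ (Fin k → Fin m) λ b →
    StrictlyIncreasing a × StrictlyIncreasing b ×
    (∀ i j → a i < b j) ×
    (∀ i → Consecutive π (a i) (b i))

-- subtype with an irrelevant property (so equality is equality of partitions)
record NoCrossingPartition (m : ℕ) (Cross : SetPartition m → Set) : Set where
  constructor _,_
  field
    partition : SetPartition m
    .noCross  : ¬ Cross partition

NoClassical : ℕ → ℕ → Set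
NoClassical k m = NoCrossingPartition m (ClassicalCrossing k)

NoEnhanced : ℕ → ℕ → Set
NoEnhanced k m = NoCrossingPartition m (EnhancedCrossing k)

-- A set partition of [m] is determined by its arcs: the pairs a < b that are consecutive in a block.
-- They form a partial injection a ↦ b with a < b (a strict arc diagram), and a classical (enhanced)
-- k-crossing is a k-crossing of arcs with a_k < b_1 (resp. a_k ≤ b_1, a singleton counting as a loop).
-- Moving every arc end b to b - 1 identifies strict diagrams on [n + 1] with weak diagrams on [n]
-- (arcs a ≤ b, loops allowed), turning classical k-crossings into weak ones (a_k ≤ b_1); adding a loop
-- at every singleton identifies strict diagrams on [i] with weak diagrams covering every point,
-- turning enhanced k-crossings into weak ones. Finally a weak diagram on [n] is a choice of the i
-- points it covers together with a weak diagram on them covering every point; this is proved by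
-- induction on the number of points not yet required to be covered: such a point is either covered
-- (require it) or isolated (delete it), which is Pascal's rule for the binomial sum.

module Submission where

open import Defs

module BinomialSums where
  open import Data.Nat using (ℕ; zero; suc; _+_; _*_)
  open import Data.Nat.Properties
    using (+-0-commutativeMonoid; +-0-monoid; +-assoc; +-comm; +-suc; +-identityʳ; *-identityˡ; *-distribʳ-+)
  open import Data.Nat.Combinatorics using (_C_; nCk+nC[k+1]≡[n+1]C[k+1])
  open import Data.Nat.ListAction as List using ()
  open import Data.List using (map; applyUpTo; upTo)
  open import Data.Fin using (toℕ)
  open import Algebra.Properties.CommutativeMonoid.Sum +-0-commutativeMonoid using (∑-distrib-+)
  open import Algebra.Properties.Monoid.Sum +-0-monoid using (sum-syntax; sum; sum-cong-≗; sum-replicate-zero)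
  open import Function using (_∘_)
  open import Relation.Binary.PropositionalEquality

  module _ (e : ℕ → ℕ) where

    -- The terms with i > f vanish, so every bound B > f gives the full sum of (f C i) * e (t + i).
    binomialSum : ℕ → ℕ → ℕ → ℕ
    binomialSum B f t = ∑[ i < B ] ((f C toℕ i) * e (t + toℕ i))

    binomialSum-zero : ∀ B t → binomialSum (suc B) 0 t ≡ e t
    binomialSum-zero B t = begin
      1 * e (t + 0) + sum {B} (λ _ → 0)  ≡⟨ cong (1 * e (t + 0) +_) (sum-replicate-zero B) ⟩
      1 * e (t + 0) + 0                  ≡⟨ +-identityʳ _ ⟩
      1 * e (t + 0)                      ≡⟨ *-identityˡ _ ⟩
      e (t + 0)                          ≡⟨ cong e (+-identityʳ t) ⟩
      e t                                ∎
      where open ≡-Reasoning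

    binomialSum-pascal : ∀ B f t →
      binomialSum (suc B) (suc f) t ≡ binomialSum (suc B) f t + binomialSum B f (suc t)
    binomialSum-pascal B f t = begin
      e₀ + ∑[ i < B ] ((suc f C suc (toℕ i)) * e (t + suc (toℕ i)))
        ≡⟨ cong (e₀ +_) (sum-cong-≗ {B} pascal) ⟩
      e₀ + ∑[ i < B ] ((f C suc (toℕ i)) * e (t + suc (toℕ i)) + (f C toℕ i) * e (suc t + toℕ i))
        ≡⟨ cong (e₀ +_) (∑-distrib-+ {B} _ _) ⟩
      e₀ + (∑[ i < B ] ((f C suc (toℕ i)) * e (t + suc (toℕ i))) + binomialSum B f (suc t))
        ≡⟨ sym (+-assoc e₀ _ _) ⟩
      binomialSum (suc B) f t + binomialSum B f (suc t) ∎
      where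
      open ≡-Reasoning
      e₀ = 1 * e (t + 0)
      pascal : ∀ i → (suc f C suc (toℕ i)) * e (t + suc (toℕ i))
                   ≡ (f C suc (toℕ i)) * e (t + suc (toℕ i)) + (f C toℕ i) * e (suc t + toℕ i)
      pascal i = begin
        (suc f C suc j) * e (t + suc j)
          ≡⟨ cong (_* e (t + suc j)) (sym (nCk+nC[k+1]≡[n+1]C[k+1] f j)) ⟩
        (f C j + f C suc j) * e (t + suc j)
          ≡⟨ *-distribʳ-+ (e (t + suc j)) (f C j) _ ⟩
        (f C j) * e (t + suc j) + (f C suc j) * e (t + suc j)
          ≡⟨ +-comm ((f C j) * e (t + suc j)) _ ⟩
        (f C suc j) * e (t + suc j) + (f C j) * e (t + suc j)
          ≡⟨ cong (λ s → (f C suc j) * e (t + suc j) + (f C j) * e s) (+-suc t j) ⟩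
        (f C suc j) * e (t + suc j) + (f C j) * e (suc t + j)
          ∎
        where j = toℕ i

    sum-map-applyUpTo : ∀ B (h g : ℕ → ℕ) → List.sum (map h (applyUpTo g B)) ≡ ∑[ i < B ] (h (g (toℕ i)))
    sum-map-applyUpTo zero h g = refl
    sum-map-applyUpTo (suc B) h g = cong (h (g 0) +_) (sum-map-applyUpTo B h (g ∘ suc))

    binomialSum-upTo : ∀ n → binomialSum (suc n) n 0 ≡ List.sum (map (λ i → (n C i) * e i) (upTo (suc n)))
    binomialSum-upTo n = sym (sum-map-applyUpTo (suc n) (λ i → (n C i) * e i) (λ i → i))

module ArcDiagrams where

  open import Data.Nat using (ℕ)
  open import Data.Fin using (Fin; _<_; _≟_)
  open import Data.Fin.Properties using (any?)
  open import Data.Vec using (Vec; lookup)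
  import Data.Vec.Properties as Vec
  open import Data.Maybe using (Maybe; just; nothing)
  import Data.Maybe.Properties as Maybe
  open import Data.Product using (Σ; ∃; _×_; _,_)
  open import Data.Sum using (_⊎_; inj₁)
  open import Function using (id; _∘_)
  open import Relation.Nullary using (¬_; Dec; contradiction)
  open import Relation.Nullary.Decidable using (recompute; _⊎-dec_)
  open import Relation.Binary using (Decidable)
  open import Relation.Binary.PropositionalEquality

  lookup-ext : ∀ {A : Set} {n} {u v : Vec A n} → (∀ i → lookup u i ≡ lookup v i) → u ≡ v
  lookup-ext {u = u} {v} eq =
    trans (sym (Vec.tabulate∘lookup u)) (trans (Vec.tabulate-cong eq) (Vec.tabulate∘lookup v))

  PartialMap : ℕ → Set
  PartialMap m = Vec (Maybe (Fin m)) m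

  infix 4 _∋_↦_
  _∋_↦_ : ∀ {m} → PartialMap m → Fin m → Fin m → Set
  v ∋ a ↦ b = lookup v a ≡ just b

  Covered : ∀ {m} → PartialMap m → Fin m → Set
  Covered v x = (∃ λ y → v ∋ x ↦ y) ⊎ (∃ λ y → v ∋ y ↦ x)

  uncovered⇒nothing : ∀ {m} (v : PartialMap m) x → ¬ Covered v x → lookup v x ≡ nothing
  uncovered⇒nothing v x uncovered with lookup v x | (λ y → uncovered ∘ inj₁ ∘ (y ,_))
  ... | nothing | _      = refl
  ... | just y  | no-out = contradiction refl (no-out y)

  covered? : ∀ {m} (v : PartialMap m) (x : Fin m) → Dec (Covered v x)
  covered? v x = any? (λ y → lookup v x ≟ₘ just y) ⊎-dec any? (λ y → lookup v y ≟ₘ just x)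
    where _≟ₘ_ = Maybe.≡-dec _≟_

  -- Set partitions give strict diagrams (≺ = <); shifting or adding loops gives weak ones (≺ = ≤).
  record IsArcDiagram {m} (_≺_ : Fin m → Fin m → Set) (v : PartialMap m) : Set where
    field
      forward   : ∀ {a b} → v ∋ a ↦ b → a ≺ b
      injective : ∀ {a a′ b} → v ∋ a ↦ b → v ∋ a′ ↦ b → a ≡ a′

  IsArcDiagram-recompute : ∀ {m} {_≺_ : Fin m → Fin m → Set} {v : PartialMap m} →
    Decidable _≺_ → .(IsArcDiagram _≺_ v) → IsArcDiagram _≺_ v
  IsArcDiagram-recompute _≺?_ d = record
    { forward   = λ {a} {b} e → recompute (a ≺? b) (IsArcDiagram.forward d e)
    ; injective = λ {a} {a′} e e′ → recompute (a ≟ a′) (IsArcDiagram.injective d e e′)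
    }

  record Crossing {m} (_≺_ Pair : Fin m → Fin m → Set) (k : ℕ) : Set where
    constructor crossing
    field
      left right       : Fin k → Fin m
      left-increasing  : StrictlyIncreasing left
      right-increasing : StrictlyIncreasing right
      left≺right       : ∀ i j → left i ≺ right j
      pairs            : ∀ i → Pair (left i) (right i)

  module _ {m} {_≺_ Pair : Fin m → Fin m → Set} {k : ℕ} where

    CrossingΣ : Set
    CrossingΣ = Σ (Fin k → Fin m) λ a → Σ (Fin k → Fin m) λ b →
      StrictlyIncreasing a × StrictlyIncreasing b × (∀ i j → a i ≺ b j) × (∀ i → Pair (a i) (b i))

    fromΣ : CrossingΣ → Crossing _≺_ Pair k
    fromΣ (a , b , a↑ , b↑ , a≺b , ab) = crossing a b a↑ b↑ a≺b ab

    toΣ : Crossing _≺_ Pair k → CrossingΣ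
    toΣ (crossing a b a↑ b↑ a≺b ab) = a , b , a↑ , b↑ , a≺b , ab

  module _ {m m′} {_≺_ P : Fin m → Fin m → Set} {_≺′_ Q : Fin m′ → Fin m′ → Set} {k : ℕ}
           (f g : Fin m → Fin m′) where

    Crossing-image :
      (∀ {x y} → x < y → f x < f y) → (∀ {x y} → x < y → g x < g y) →
      (∀ {x y} → x ≺ y → f x ≺′ g y) → (∀ {x y} → P x y → Q (f x) (g y)) →
      Crossing _≺_ P k → Crossing _≺′_ Q k
    Crossing-image f-mono g-mono fg-≺ fg-P (crossing a b a↑ b↑ a≺b pairs) = crossing
      (f ∘ a) (g ∘ b)
      (λ i j i<j → f-mono (a↑ i j i<j))
      (λ i j i<j → g-mono (b↑ i j i<j))
      (λ i j → fg-≺ (a≺b i j))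
      (λ i → fg-P (pairs i))

    Crossing-preimage :
      (∀ {x y} → f x < f y → x < y) → (∀ {x y} → g x < g y → x < y) →
      (∀ {x y} → f x ≺′ g y → x ≺ y) →
      (∀ {x′ y′} → Q x′ y′ → Σ (Fin m) λ x → Σ (Fin m) λ y → x′ ≡ f x × y′ ≡ g y × P x y) →
      Crossing _≺′_ Q k → Crossing _≺_ P k
    Crossing-preimage f-cancel g-cancel fg-≺ preimage (crossing a b a↑ b↑ a≺b pairs) = crossing
      a′ b′
      (λ i j i<j → f-cancel (subst₂ _<_ (a≡ i) (a≡ j) (a↑ i j i<j)))
      (λ i j i<j → g-cancel (subst₂ _<_ (b≡ i) (b≡ j) (b↑ i j i<j)))
      (λ i j → fg-≺ (subst₂ _≺′_ (a≡ i) (b≡ j) (a≺b i j)))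
      (λ i → let (_ , _ , _ , _ , p) = preimage (pairs i) in p)
      where
      a′ b′ : Fin k → Fin m
      a′ i = let (x , _) = preimage (pairs i) in x
      b′ i = let (_ , y , _) = preimage (pairs i) in y
      a≡ : ∀ i → a i ≡ f (a′ i)
      a≡ i = let (_ , _ , e , _) = preimage (pairs i) in e
      b≡ : ∀ i → b i ≡ g (b′ i)
      b≡ i = let (_ , _ , _ , e , _) = preimage (pairs i) in e

  Crossing-mapPairs : ∀ {m} {_≺_ P Q : Fin m → Fin m → Set} {k} →
    (∀ {x y} → P x y → Q x y) → Crossing _≺_ P k → Crossing _≺_ Q k
  Crossing-mapPairs = Crossing-image id id id id id

module PointDeletion where

  open ArcDiagrams
  open import Data.Nat using (ℕ; suc)
  import Data.Nat.Properties as ℕ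
  open import Data.Fin using (Fin; _≤_; _<_; _≟_; punchIn; punchOut)
  open import Data.Fin.Properties
    using (punchIn-injective; punchInᵢ≢i; punchIn-punchOut; punchOut-punchIn; punchIn-mono-≤; punchIn-cancel-≤; ≤∧≢⇒<; <⇒≢)
  import Data.Vec as Vec
  open import Data.Vec using (lookup; tabulate; insertAt)
  import Data.Vec.Properties as Vec
  open import Data.Maybe using (Maybe; just; nothing; map; _>>=_)
  open import Data.Maybe.Properties using (just-injective)
  open import Data.Product using (Σ; _×_; _,_)
  open import Data.Sum using (inj₁; inj₂)
  open import Function using (_∘_; case_of_)
  open import Relation.Nullary using (¬_; yes; no; contradiction)
  open import Relation.Binary.PropositionalEquality

  punchIn-mono-< : ∀ {n} (i : Fin (suc n)) {j k : Fin n} → j < k → punchIn i j < punchIn i k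
  punchIn-mono-< i {j} {k} j<k =
    ≤∧≢⇒< (punchIn-mono-≤ i j k (ℕ.<⇒≤ j<k)) (<⇒≢ j<k ∘ punchIn-injective i j k)

  punchIn-cancel-< : ∀ {n} (i : Fin (suc n)) {j k : Fin n} → punchIn i j < punchIn i k → j < k
  punchIn-cancel-< i {j} {k} ij<ik = ℕ.≰⇒> λ k≤j → ℕ.<⇒≱ ij<ik (punchIn-mono-≤ i k j k≤j)

  module _ {N : ℕ} (x : Fin (suc N)) where

    data PunchInView : Fin (suc N) → Set where
      at-x     : PunchInView x
      punchIn⁺ : ∀ y → PunchInView (punchIn x y)

    punchInView : ∀ z → PunchInView z
    punchInView z with x ≟ z
    ... | yes refl = at-x
    ... | no x≢z   = subst PunchInView (punchIn-punchOut x≢z) (punchIn⁺ (punchOut x≢z))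

    punchOutᵐ : Fin (suc N) → Maybe (Fin N)
    punchOutᵐ z with x ≟ z
    ... | yes _   = nothing
    ... | no x≢z  = just (punchOut x≢z)

    punchOutᵐ-just : ∀ {z w} → punchOutᵐ z ≡ just w → z ≡ punchIn x w
    punchOutᵐ-just {z} e with x ≟ z
    punchOutᵐ-just () | yes _
    punchOutᵐ-just refl | no x≢z = sym (punchIn-punchOut x≢z)

    punchOutᵐ-punchIn : ∀ w → punchOutᵐ (punchIn x w) ≡ just w
    punchOutᵐ-punchIn w with x ≟ punchIn x w
    ... | yes x≡ = contradiction (sym x≡) (punchInᵢ≢i x w)
    ... | no _   = cong just (punchOut-punchIn x)

    delete : PartialMap (suc N) → PartialMap N
    delete v = tabulate λ y → lookup v (punchIn x y) >>= punchOutᵐ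

    insert : PartialMap N → PartialMap (suc N)
    insert w = insertAt (Vec.map (map (punchIn x)) w) x nothing

    lookup-delete : ∀ v y → lookup (delete v) y ≡ (lookup v (punchIn x y) >>= punchOutᵐ)
    lookup-delete v = Vec.lookup∘tabulate _

    lookup-insert-x : ∀ w → lookup (insert w) x ≡ nothing
    lookup-insert-x w = Vec.insertAt-lookup _ x nothing

    lookup-insert-punchIn : ∀ w y → lookup (insert w) (punchIn x y) ≡ map (punchIn x) (lookup w y)
    lookup-insert-punchIn w y = trans (Vec.insertAt-punchIn _ x nothing y) (Vec.lookup-map y _ w)

    delete⁻ : ∀ v {y w} → delete v ∋ y ↦ w → v ∋ punchIn x y ↦ punchIn x w
    delete⁻ v {y} e with lookup v (punchIn x y) | lookup-delete v y
    ... | nothing | e′ = case trans (sym e) e′ of λ ()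
    ... | just z  | e′ = cong just (punchOutᵐ-just (trans (sym e′) e))

    delete⁺ : ∀ v {y w} → v ∋ punchIn x y ↦ punchIn x w → delete v ∋ y ↦ w
    delete⁺ v {y} {w} e = begin
      lookup (delete v) y                     ≡⟨ lookup-delete v y ⟩
      (lookup v (punchIn x y) >>= punchOutᵐ)  ≡⟨ cong (_>>= punchOutᵐ) e ⟩
      punchOutᵐ (punchIn x w)                 ≡⟨ punchOutᵐ-punchIn w ⟩
      just w                                  ∎
      where open ≡-Reasoning

    insert⁺ : ∀ w {y z} → w ∋ y ↦ z → insert w ∋ punchIn x y ↦ punchIn x z
    insert⁺ w {y} e = trans (lookup-insert-punchIn w y) (cong (map (punchIn x)) e)

    insert⁻ : ∀ w {a b} → insert w ∋ a ↦ b →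
      Σ (Fin N) λ y → Σ (Fin N) λ z → a ≡ punchIn x y × b ≡ punchIn x z × w ∋ y ↦ z
    insert⁻ w {a} e with punchInView a
    ... | at-x = case trans (sym e) (lookup-insert-x w) of λ ()
    ... | punchIn⁺ y with lookup w y in wy | lookup-insert-punchIn w y
    ...   | nothing | e′ = case trans (sym e) e′ of λ ()
    ...   | just z  | e′ = y , z , refl , just-injective (trans (sym e) e′) , wy

    delete-insert : ∀ w → delete (insert w) ≡ w
    delete-insert w = lookup-ext λ y → begin
      lookup (delete (insert w)) y                     ≡⟨ lookup-delete (insert w) y ⟩
      (lookup (insert w) (punchIn x y) >>= punchOutᵐ)  ≡⟨ cong (_>>= punchOutᵐ) (lookup-insert-punchIn w y) ⟩
      (map (punchIn x) (lookup w y) >>= punchOutᵐ)     ≡⟨ punchOutᵐ∘punchIn (lookup w y) ⟩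
      lookup w y                                       ∎
      where
      open ≡-Reasoning
      punchOutᵐ∘punchIn : ∀ mz → (map (punchIn x) mz >>= punchOutᵐ) ≡ mz
      punchOutᵐ∘punchIn nothing  = refl
      punchOutᵐ∘punchIn (just z) = punchOutᵐ-punchIn z

    insert-delete : ∀ v → ¬ Covered v x → insert (delete v) ≡ v
    insert-delete v uncovered = lookup-ext λ a → reinsert a (punchInView a)
      where
      reinsert : ∀ a → PunchInView a → lookup (insert (delete v)) a ≡ lookup v a
      reinsert _ at-x = trans (lookup-insert-x (delete v)) (sym (uncovered⇒nothing v x uncovered))
      reinsert _ (punchIn⁺ y) with lookup v (punchIn x y) in e | lookup-delete v y
      ... | nothing | e′ = trans (lookup-insert-punchIn (delete v) y) (cong (map (punchIn x)) e′)
      ... | just z  | e′ with punchInView z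
      ...   | at-x       = contradiction (inj₂ (punchIn x y , e)) uncovered
      ...   | punchIn⁺ w = begin
        lookup (insert (delete v)) (punchIn x y)  ≡⟨ lookup-insert-punchIn (delete v) y ⟩
        map (punchIn x) (lookup (delete v) y)     ≡⟨ cong (map (punchIn x)) (trans e′ (punchOutᵐ-punchIn w)) ⟩
        just (punchIn x w)                        ∎
        where open ≡-Reasoning

    insert-uncovered : ∀ w → ¬ Covered (insert w) x
    insert-uncovered w (inj₁ (_ , e)) = case trans (sym e) (lookup-insert-x w) of λ ()
    insert-uncovered w (inj₂ (_ , e)) with insert⁻ w e
    ... | _ , z , _ , x≡ , _ = punchInᵢ≢i x z (sym x≡)

    insert-covered : ∀ w {y} → Covered w y → Covered (insert w) (punchIn x y)
    insert-covered w (inj₁ (z , e)) = inj₁ (punchIn x z , insert⁺ w e)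
    insert-covered w (inj₂ (z , e)) = inj₂ (punchIn x z , insert⁺ w e)

    delete-covered : ∀ v {y} → ¬ Covered v x → Covered v (punchIn x y) → Covered (delete v) y
    delete-covered v uncovered (inj₁ (z , e)) with punchInView z
    ... | at-x       = contradiction (inj₂ (_ , e)) uncovered
    ... | punchIn⁺ w = inj₁ (w , delete⁺ v e)
    delete-covered v uncovered (inj₂ (z , e)) with punchInView z
    ... | at-x       = contradiction (inj₁ (_ , e)) uncovered
    ... | punchIn⁺ w = inj₂ (w , delete⁺ v e)

    delete-isWeak : ∀ {v} → IsArcDiagram _≤_ v → IsArcDiagram _≤_ (delete v)
    delete-isWeak {v} d = record
      { forward   = λ e → punchIn-cancel-≤ x _ _ (forward (delete⁻ v e))
      ; injective = λ e e′ → punchIn-injective x _ _ (injective (delete⁻ v e) (delete⁻ v e′))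
      }
      where open IsArcDiagram d

    insert-isWeak : ∀ {w} → IsArcDiagram _≤_ w → IsArcDiagram _≤_ (insert w)
    insert-isWeak {w} d = record { forward = forward′ ; injective = injective′ }
      where
      open IsArcDiagram d
      forward′ : ∀ {a b} → insert w ∋ a ↦ b → a ≤ b
      forward′ e with insert⁻ w e
      ... | y , z , refl , refl , e′ = punchIn-mono-≤ x y z (forward e′)
      injective′ : ∀ {a a′ b} → insert w ∋ a ↦ b → insert w ∋ a′ ↦ b → a ≡ a′
      injective′ e e′ with insert⁻ w e | insert⁻ w e′
      ... | y , z , refl , refl , f | y′ , z′ , refl , z≡z′ , f′ =
        cong (punchIn x) (injective f (subst (w ∋ y′ ↦_) (sym (punchIn-injective x z z′ z≡z′)) f′))

    delete-crossing : ∀ {k} v → Crossing _≤_ (delete v ∋_↦_) k → Crossing _≤_ (v ∋_↦_) k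
    delete-crossing v = Crossing-image (punchIn x) (punchIn x)
      (punchIn-mono-< x) (punchIn-mono-< x) (λ {y} {z} → punchIn-mono-≤ x y z) (delete⁻ v)

    insert-crossing : ∀ {k} w → Crossing _≤_ (insert w ∋_↦_) k → Crossing _≤_ (w ∋_↦_) k
    insert-crossing w = Crossing-preimage (punchIn x) (punchIn x)
      (punchIn-cancel-< x) (punchIn-cancel-< x) (punchIn-cancel-≤ x _ _) (insert⁻ w)

module WeakConfigurations where

  open ArcDiagrams
  open PointDeletion
  open import Data.Nat using (ℕ; suc)
  open import Data.Bool using (Bool; true; false)
  open import Data.Fin using (Fin; _≤_; _≟_; punchIn)
  open import Data.Fin.Properties using (punchOut-punchIn; punchInᵢ≢i)
  open import Data.Vec using (Vec; lookup; removeAt; _[_]≔_)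
  import Data.Vec.Properties as Vec
  open import Data.Sum using (_⊎_; inj₁; inj₂)
  open import Data.Empty.Irrelevant using (⊥-elim)
  open import Function using (_∘_; case_of_)
  open import Function.Bundles using (_↔_; mk↔ₛ′)
  open import Relation.Nullary using (¬_; yes; no; contradiction)
  open import Relation.Binary.PropositionalEquality

  record WeakNoncrossing (k : ℕ) {N : ℕ} (marked : Vec Bool N) : Set where
    constructor weakNoncrossing
    field
      arcs        : PartialMap N
      .isWeak     : IsArcDiagram _≤_ arcs
      .noCrossing : ¬ Crossing _≤_ (arcs ∋_↦_) k
      .covers     : ∀ x → lookup marked x ≡ true → Covered arcs x
  open WeakNoncrossing public

  WeakNoncrossing-ext : ∀ {k N} {marked : Vec Bool N} {c d : WeakNoncrossing k marked} → arcs c ≡ arcs d → c ≡ d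
  WeakNoncrossing-ext {c = weakNoncrossing _ _ _ _} {weakNoncrossing _ _ _ _} refl = refl

  lookup-removeAt : ∀ {A : Set} {n} (xs : Vec A (suc n)) i j → lookup (removeAt xs i) j ≡ lookup xs (punchIn i j)
  lookup-removeAt xs i j =
    trans (cong (lookup (removeAt xs i)) (sym (punchOut-punchIn i))) (Vec.removeAt-punchOut xs (punchInᵢ≢i i j ∘ sym))

  module _ {k N : ℕ} (marked : Vec Bool (suc N)) (x : Fin (suc N)) (x-unmarked : lookup marked x ≡ false) where

    private
      marked⁺ : Vec Bool (suc N)
      marked⁺ = marked [ x ]≔ true

      marked⁻ : Vec Bool N
      marked⁻ = removeAt marked x

      x-unmarked⇒≢ : ∀ {y} → lookup marked y ≡ true → y ≢ x
      x-unmarked⇒≢ y-marked refl = case trans (sym x-unmarked) y-marked of λ ()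

      mark : (c : WeakNoncrossing k marked) → Covered (arcs c) x → WeakNoncrossing k marked⁺
      mark (weakNoncrossing v weak nc covers) x-covered = weakNoncrossing v weak nc (covers⁺ covers)
        where
        covers⁺ : (∀ y → lookup marked y ≡ true → Covered v y) → ∀ y → lookup marked⁺ y ≡ true → Covered v y
        covers⁺ covers y y-marked with y ≟ x
        ... | yes refl = x-covered
        ... | no y≢x   = covers y (trans (sym (Vec.lookup∘update′ y≢x marked true)) y-marked)

      unmark : WeakNoncrossing k marked⁺ → WeakNoncrossing k marked
      unmark (weakNoncrossing v weak nc covers) = weakNoncrossing v weak nc λ y y-marked →
        covers y (trans (Vec.lookup∘update′ (x-unmarked⇒≢ y-marked) marked true) y-marked)

      remove : (c : WeakNoncrossing k marked) → ¬ Covered (arcs c) x → WeakNoncrossing k marked⁻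
      remove (weakNoncrossing v weak nc covers) x-uncovered =
        weakNoncrossing (delete x v) (delete-isWeak x weak) (nc ∘ delete-crossing x v) λ y y-marked →
          delete-covered x v x-uncovered (covers (punchIn x y) (trans (sym (lookup-removeAt marked x y)) y-marked))

      restore : WeakNoncrossing k marked⁻ → WeakNoncrossing k marked
      restore (weakNoncrossing w weak nc covers) =
        weakNoncrossing (insert x w) (insert-isWeak x weak) (nc ∘ insert-crossing x w) (covers′ covers)
        where
        covers′ : (∀ z → lookup marked⁻ z ≡ true → Covered w z) →
                  ∀ y → lookup marked y ≡ true → Covered (insert x w) y
        covers′ covers y y-marked with punchInView x y
        ... | at-x       = ⊥-elim (x-unmarked⇒≢ y-marked refl)
        ... | punchIn⁺ z = insert-covered x w (covers z (trans (lookup-removeAt marked x z) y-marked))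

      to : WeakNoncrossing k marked → WeakNoncrossing k marked⁺ ⊎ WeakNoncrossing k marked⁻
      to c with covered? (arcs c) x
      ... | yes x-covered  = inj₁ (mark c x-covered)
      ... | no x-uncovered = inj₂ (remove c x-uncovered)

      from : WeakNoncrossing k marked⁺ ⊎ WeakNoncrossing k marked⁻ → WeakNoncrossing k marked
      from (inj₁ c) = unmark c
      from (inj₂ c) = restore c

      from∘to : ∀ c → from (to c) ≡ c
      from∘to c with covered? (arcs c) x
      ... | yes _          = WeakNoncrossing-ext refl
      ... | no x-uncovered = WeakNoncrossing-ext (insert-delete x (arcs c) x-uncovered)

      to∘from : ∀ c → to (from c) ≡ c
      to∘from (inj₁ (weakNoncrossing v _ _ covers)) with covered? v x
      ... | yes _          = cong inj₁ (WeakNoncrossing-ext refl)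
      ... | no x-uncovered = ⊥-elim (x-uncovered (covers x (Vec.lookup∘update x marked true)))
      to∘from (inj₂ (weakNoncrossing w _ _ _)) with covered? (insert x w) x
      ... | yes x-covered = contradiction x-covered (insert-uncovered x w)
      ... | no _          = cong inj₂ (WeakNoncrossing-ext (delete-insert x w))

    split : WeakNoncrossing k marked ↔ (WeakNoncrossing k marked⁺ ⊎ WeakNoncrossing k marked⁻)
    split = mk↔ₛ′ to from to∘from from∘to

module Counting where

  open ArcDiagrams
  open WeakConfigurations
  open BinomialSums
  open import Data.Nat using (ℕ; zero; suc; _+_; _≤_; _<_; s≤s)
  import Data.Nat.Properties as ℕ
  open import Data.Bool using (Bool; true; false)
  open import Data.Fin using (Fin; zero; suc)
  open import Data.Fin.Properties using (+↔⊎)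
  open import Data.Vec using (Vec; []; _∷_; lookup; removeAt; _[_]≔_; replicate)
  open import Data.Product using (Σ; _×_; _,_)
  open import Data.Sum using (_⊎_)
  open import Data.Sum.Algebra using (⊎-comm)
  open import Data.Sum.Function.Propositional using (_⊎-↔_)
  open import Function.Bundles using (_↔_)
  open import Function.Related.Propositional using (bijection; module EquationalReasoning)
  open import Relation.Binary.PropositionalEquality

  unmarked : ∀ {N} → Vec Bool N → ℕ
  unmarked []          = 0
  unmarked (true ∷ p)  = unmarked p
  unmarked (false ∷ p) = suc (unmarked p)

  marked : ∀ {N} → Vec Bool N → ℕ
  marked []          = 0
  marked (true ∷ p)  = suc (marked p)
  marked (false ∷ p) = marked p

  mark-counts : ∀ {N} (p : Vec Bool N) x → lookup p x ≡ false →
    unmarked p ≡ suc (unmarked (p [ x ]≔ true)) × marked (p [ x ]≔ true) ≡ suc (marked p)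
  mark-counts (false ∷ p) zero    _ = refl , refl
  mark-counts (true ∷ p)  (suc x) e = let (u , m) = mark-counts p x e in u , cong suc m
  mark-counts (false ∷ p) (suc x) e = let (u , m) = mark-counts p x e in cong suc u , m

  removeAt-counts : ∀ {N} (p : Vec Bool (suc N)) x → lookup p x ≡ false →
    unmarked p ≡ suc (unmarked (removeAt p x)) × marked (removeAt p x) ≡ marked p
  removeAt-counts (false ∷ p)            zero    _ = refl , refl
  removeAt-counts (true ∷ p@(_ ∷ _))  (suc x) e = let (u , m) = removeAt-counts p x e in u , cong suc m
  removeAt-counts (false ∷ p@(_ ∷ _)) (suc x) e = let (u , m) = removeAt-counts p x e in cong suc u , m

  unmarked-point : ∀ {N f} (p : Vec Bool N) → unmarked p ≡ suc f → Σ (Fin N) λ x → lookup p x ≡ false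
  unmarked-point (false ∷ p) _ = zero , refl
  unmarked-point (true ∷ p)  e = let (x , e′) = unmarked-point p e in suc x , e′

  all-marked : ∀ {N} (p : Vec Bool N) → unmarked p ≡ 0 → p ≡ replicate N true × marked p ≡ N
  all-marked []         _ = refl , refl
  all-marked (true ∷ p) e = let (p≡ , m) = all-marked p e in cong (true ∷_) p≡ , cong suc m

  unmarked-replicate : ∀ N → unmarked (replicate N false) ≡ N
  unmarked-replicate zero    = refl
  unmarked-replicate (suc N) = cong suc (unmarked-replicate N)

  marked-replicate : ∀ N → marked (replicate N false) ≡ 0
  marked-replicate zero    = refl
  marked-replicate (suc N) = marked-replicate N

  module _ (k n : ℕ) (e : ℕ → ℕ)
           (fully-marked : ∀ i → i ≤ n → WeakNoncrossing k (replicate i true) ↔ Fin (e i)) where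

    open EquationalReasoning {k = bijection}

    count : ∀ f {N} (p : Vec Bool N) → unmarked p ≡ f → N ≤ n →
      ∀ B → f < B → WeakNoncrossing k p ↔ Fin (binomialSum e B f (marked p))
    count zero {N} p p-full N≤n (suc B) _ with all-marked p p-full
    ... | refl , marked≡N = begin
      WeakNoncrossing k (replicate N true)  ↔⟨ fully-marked N N≤n ⟩
      Fin (e N)                             ≡⟨ cong Fin (sym (trans (binomialSum-zero e B _) (cong e marked≡N))) ⟩
      Fin (binomialSum e (suc B) 0 (marked (replicate N true))) ∎
    count (suc f) [] ()
    count (suc f) p@(_ ∷ _) p-f N≤n (suc B) (s≤s f<B) with unmarked-point p p-f
    ... | x , x-unmarked with mark-counts p x x-unmarked | removeAt-counts p x x-unmarked
    ...   | u⁺ , m⁺ | u⁻ , m⁻ = begin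
      WeakNoncrossing k p
        ↔⟨ split p x x-unmarked ⟩
      (WeakNoncrossing k (p [ x ]≔ true) ⊎ WeakNoncrossing k (removeAt p x))
        ↔⟨ count⁺ ⊎-↔ count⁻ ⟩
      (Fin (binomialSum e B f (suc t)) ⊎ Fin (binomialSum e (suc B) f t))
        ↔⟨ ⊎-comm _ _ ⟩
      (Fin (binomialSum e (suc B) f t) ⊎ Fin (binomialSum e B f (suc t)))
        ↔⟨ +↔⊎ ⟨
      Fin (binomialSum e (suc B) f t + binomialSum e B f (suc t))
        ≡⟨ cong Fin (sym (binomialSum-pascal e B f t)) ⟩
      Fin (binomialSum e (suc B) (suc f) t) ∎
      where
      t = marked p
      count⁺ : WeakNoncrossing k (p [ x ]≔ true) ↔ Fin (binomialSum e B f (suc t))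
      count⁺ = subst (λ s → WeakNoncrossing k (p [ x ]≔ true) ↔ Fin (binomialSum e B f s)) m⁺
        (count f (p [ x ]≔ true) (ℕ.suc-injective (trans (sym u⁺) p-f)) N≤n B f<B)
      count⁻ : WeakNoncrossing k (removeAt p x) ↔ Fin (binomialSum e (suc B) f t)
      count⁻ = subst (λ s → WeakNoncrossing k (removeAt p x) ↔ Fin (binomialSum e (suc B) f s)) m⁻
        (count f (removeAt p x) (ℕ.suc-injective (trans (sym u⁻) p-f)) (ℕ.≤-trans (ℕ.n≤1+n _) N≤n)
               (suc B) (ℕ.m≤n⇒m≤1+n f<B))

    count-unmarked : WeakNoncrossing k (replicate n false) ↔ Fin (binomialSum e (suc n) n 0)
    count-unmarked = subst (λ t → WeakNoncrossing k (replicate n false) ↔ Fin (binomialSum e (suc n) n t))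
      (marked-replicate n) (count n (replicate n false) (unmarked-replicate n) ℕ.≤-refl (suc n) ℕ.≤-refl)

module StandardRepresentation where

  open ArcDiagrams
  open import Data.Nat.Base as ℕ using (ℕ; zero; suc)
  import Data.Nat.Properties as ℕ
  open import Data.Fin using (Fin; toℕ; _≤_; _<_; _≟_)
  open import Data.Fin.Properties using (any?; all?; _<?_; _≤?_; <-cmp; <⇒≢)
  open import Data.Vec using (lookup; tabulate)
  import Data.Vec.Properties as Vec
  open import Data.Maybe using (Maybe; just; nothing)
  import Data.Maybe.Properties as Maybe
  open import Data.Maybe.Properties using (just-injective)
  open import Data.Product using (∃; _×_; _,_)
  open import Data.Sum using (inj₁; inj₂)
  open import Function using (case_of_)
  open import Relation.Nullary using (¬_; Dec; yes; no; contradiction)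
  open import Relation.Nullary.Decidable using (_×-dec_; _→-dec_; ¬?; recompute)
  open import Relation.Binary using (tri<; tri≈; tri>)
  open import Relation.Binary.PropositionalEquality

  record StrictDiagram (m : ℕ) : Set where
    constructor strictDiagram
    field
      arcs      : PartialMap m
      .isStrict : IsArcDiagram _<_ arcs
  open StrictDiagram public

  StrictDiagram-ext : ∀ {m} {D E : StrictDiagram m} → arcs D ≡ arcs E → D ≡ E
  StrictDiagram-ext {D = strictDiagram _ _} {strictDiagram _ _} refl = refl

  SetPartition-ext : ∀ {m} {π σ : SetPartition m} → rep π ≡ rep σ → π ≡ σ
  SetPartition-ext {π = mkPartition _ _ _} {mkPartition _ _ _} refl = refl

  module FromPartition {m : ℕ} (π : SetPartition m) where

    private
      R : Fin m → Fin m
      R = lookup (rep π)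

    consecutive? : ∀ a b → Dec (Consecutive π a b)
    consecutive? a b =
      (a <? b) ×-dec (R a ≟ R b) ×-dec all? λ x → (a <? x) →-dec (x <? b) →-dec ¬? (R a ≟ R x)

    consecutive-functional : ∀ {a b b′} → Consecutive π a b → Consecutive π a b′ → b ≡ b′
    consecutive-functional {b = b} {b′} (a<b , ab , between) (a<b′ , ab′ , between′) with <-cmp b b′
    ... | tri< b<b′ _ _ = contradiction ab (between′ b a<b b<b′)
    ... | tri≈ _ b≡b′ _ = b≡b′
    ... | tri> _ _ b′<b = contradiction ab′ (between b′ a<b′ b′<b)

    consecutive-injective : ∀ {a a′ b} → Consecutive π a b → Consecutive π a′ b → a ≡ a′
    consecutive-injective {a} {a′} (a<b , ab , between) (a′<b , a′b , between′) with <-cmp a a′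
    ... | tri< a<a′ _ _ = contradiction (trans ab (sym a′b)) (between a′ a<a′ a′<b)
    ... | tri≈ _ a≡a′ _ = a≡a′
    ... | tri> _ _ a′<a = contradiction (trans a′b (sym ab)) (between′ a a′<a a<b)

    successor : Fin m → Maybe (Fin m)
    successor a with any? (consecutive? a)
    ... | yes (b , _) = just b
    ... | no _        = nothing

    successors : PartialMap m
    successors = tabulate successor

    successor-just : ∀ {a b} → successor a ≡ just b → Consecutive π a b
    successor-just {a} e with any? (consecutive? a)
    successor-just refl | yes (_ , ab) = ab
    successor-just ()   | no _

    consecutive⇒successor : ∀ {a b} → Consecutive π a b → successor a ≡ just b
    consecutive⇒successor {a} {b} ab with any? (consecutive? a)
    ... | yes (_ , ab′) = cong just (consecutive-functional ab′ ab)
    ... | no ¬ab        = contradiction (b , ab) ¬ab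

    ∋⇒consecutive : ∀ {a b} → successors ∋ a ↦ b → Consecutive π a b
    ∋⇒consecutive {a} e = successor-just (trans (sym (Vec.lookup∘tabulate successor a)) e)

    consecutive⇒∋ : ∀ {a b} → Consecutive π a b → successors ∋ a ↦ b
    consecutive⇒∋ {a} ab = trans (Vec.lookup∘tabulate successor a) (consecutive⇒successor ab)

    successors-strict : IsArcDiagram _<_ successors
    successors-strict = record
      { forward   = λ e → let (a<b , _) = ∋⇒consecutive e in a<b
      ; injective = λ e e′ → consecutive-injective (∋⇒consecutive e) (∋⇒consecutive e′)
      }

    diagram : StrictDiagram m
    diagram = strictDiagram successors successors-strict

    -- Shrink [a, b] while some element of the block lies strictly inside; s is fuel.
    consecutive-after : ∀ s {a b} → toℕ b ℕ.< s → R a ≡ R b → a < b → ∃ λ c → Consecutive π a c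
    consecutive-after (suc s) {a} {b} b<s ab a<b with any? (λ z → (a <? z) ×-dec (z <? b) ×-dec (R a ≟ R z))
    ... | yes (z , a<z , z<b , az) = consecutive-after s (ℕ.≤-trans z<b (ℕ.≤-pred b<s)) az a<z
    ... | no nothing-between       = b , a<b , ab , λ z a<z z<b az → nothing-between (z , a<z , z<b , az)

    consecutive-before : ∀ s {a b} → toℕ b ℕ.< toℕ a ℕ.+ s → R a ≡ R b → a < b → ∃ λ c → Consecutive π c b
    consecutive-before zero {a} {b} b<a+0 _ a<b =
      contradiction (subst (toℕ b ℕ.<_) (ℕ.+-identityʳ _) b<a+0) (ℕ.<-asym a<b)
    consecutive-before (suc s) {a} {b} b<a+s ab a<b with any? (λ z → (a <? z) ×-dec (z <? b) ×-dec (R a ≟ R z))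
    ... | yes (z , a<z , z<b , az) =
      consecutive-before s (ℕ.<-≤-trans b<a+s (subst (ℕ._≤ toℕ z ℕ.+ s) (sym (ℕ.+-suc (toℕ a) s)) (ℕ.+-monoˡ-≤ s a<z)))
        (trans (sym az) ab) z<b
    ... | no nothing-between = a , a<b , ab , λ z a<z z<b az → nothing-between (z , a<z , z<b , az)

    singleton⇒uncovered : ∀ {a} → Singleton π a → ¬ Covered successors a
    singleton⇒uncovered {a} single (inj₁ (b , e)) =
      let (a<b , ab , _) = ∋⇒consecutive e in <⇒≢ a<b (sym (single b ab))
    singleton⇒uncovered {a} single (inj₂ (b , e)) =
      let (b<a , ba , _) = ∋⇒consecutive e in <⇒≢ b<a (single b (sym ba))

    uncovered⇒singleton : ∀ {a} → ¬ Covered successors a → Singleton π a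
    uncovered⇒singleton {a} uncovered x ax with <-cmp a x
    ... | tri< a<x _ _ =
      let (c , ac) = consecutive-after (suc (toℕ x)) (ℕ.n<1+n _) ax a<x in
      contradiction (inj₁ (c , consecutive⇒∋ ac)) uncovered
    ... | tri≈ _ a≡x _ = sym a≡x
    ... | tri> _ _ x<a =
      let (c , ca) = consecutive-before (suc (toℕ a)) (ℕ.≤-trans (ℕ.n<1+n _) (ℕ.m≤n+m _ (toℕ x))) (sym ax) x<a in
      contradiction (inj₂ (c , consecutive⇒∋ ca)) uncovered

  module ToPartition {m : ℕ} (v : PartialMap m) (strict : IsArcDiagram _<_ v) where

    open IsArcDiagram strict

    HasPredecessor : Fin m → Set
    HasPredecessor x = ∃ λ y → v ∋ y ↦ x

    predecessor? : ∀ x → Dec (HasPredecessor x)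
    predecessor? x = any? λ y → Maybe.≡-dec _≟_ (lookup v y) (just x)

    walkBack : ℕ → Fin m → Fin m
    walkBack zero    x = x
    walkBack (suc s) x with predecessor? x
    ... | yes (y , _) = walkBack s y
    ... | no _        = x

    walkBack-≤ : ∀ s x → walkBack s x ≤ x
    walkBack-≤ zero    x = ℕ.≤-refl
    walkBack-≤ (suc s) x with predecessor? x
    ... | yes (y , yx) = ℕ.≤-trans (walkBack-≤ s y) (ℕ.<⇒≤ (forward yx))
    ... | no _         = ℕ.≤-refl

    walkBack-initial : ∀ s {x} → ¬ HasPredecessor x → walkBack s x ≡ x
    walkBack-initial zero    _     = refl
    walkBack-initial (suc s) {x} ¬yx with predecessor? x
    ... | yes yx = contradiction yx ¬yx
    ... | no _   = refl

    walkBack-∋ : ∀ s {x y} → v ∋ y ↦ x → walkBack (suc s) x ≡ walkBack s y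
    walkBack-∋ s {x} yx with predecessor? x
    ... | yes (y′ , y′x) = cong (walkBack s) (injective y′x yx)
    ... | no ¬yx         = contradiction (_ , yx) ¬yx

    walkBack-ends : ∀ s x → toℕ x ℕ.< s → ¬ HasPredecessor (walkBack s x)
    walkBack-ends (suc s) x x<s with predecessor? x
    ... | yes (y , yx) = walkBack-ends s y (ℕ.<-≤-trans (forward yx) (ℕ.≤-pred x<s))
    ... | no ¬yx       = ¬yx

    walkBack-fuel : ∀ s s′ x → toℕ x ℕ.< s → toℕ x ℕ.< s′ → walkBack s x ≡ walkBack s′ x
    walkBack-fuel (suc s) (suc s′) x x<s x<s′ with predecessor? x
    ... | yes (y , yx) = walkBack-fuel s s′ y (below x<s) (below x<s′)
      where
      below : ∀ {t} → toℕ x ℕ.< suc t → toℕ y ℕ.< t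
      below x<t = ℕ.<-≤-trans (forward yx) (ℕ.≤-pred x<t)
    ... | no _ = refl

    first : Fin m → Fin m
    first x = walkBack (suc (toℕ x)) x

    first-∋ : ∀ {x y} → v ∋ y ↦ x → first x ≡ first y
    first-∋ {x} {y} yx =
      trans (walkBack-∋ (toℕ x) yx) (walkBack-fuel (toℕ x) (suc (toℕ y)) y (forward yx) (ℕ.n<1+n _))

    first-idem : ∀ x → first (first x) ≡ first x
    first-idem x = walkBack-initial (suc (toℕ (first x))) (walkBack-ends (suc (toℕ x)) x (ℕ.n<1+n _))

    arc-within : ∀ s {a b} → toℕ b ℕ.< s → first a ≡ first b → a < b → ∃ λ c → v ∋ a ↦ c × c ≤ b
    arc-within (suc s) {a} {b} b<s ab a<b = by-predecessor (predecessor? b)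
      where
      by-predecessor : Dec (HasPredecessor b) → ∃ λ c → v ∋ a ↦ c × c ≤ b
      by-predecessor (no ¬yb) =
        contradiction (subst (_≤ a) (trans ab (walkBack-initial _ ¬yb)) (walkBack-≤ _ a)) (ℕ.<⇒≱ a<b)
      by-predecessor (yes (y , yb)) with <-cmp a y
      ... | tri≈ _ refl _ = b , yb , ℕ.≤-refl
      ... | tri< a<y _ _ =
        let (c , ac , c≤y) = arc-within s (ℕ.<-≤-trans (forward yb) (ℕ.≤-pred b<s)) (trans ab (first-∋ yb)) a<y in
        c , ac , ℕ.≤-trans c≤y (ℕ.<⇒≤ (forward yb))
      ... | tri> _ _ y<a =
        let (c , yc , c≤a) = arc-within s (ℕ.<-≤-trans a<b (ℕ.≤-pred b<s)) (trans (sym (first-∋ yb)) (sym ab)) y<a in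
        contradiction (subst (_≤ a) (just-injective (trans (sym yc) yb)) c≤a) (ℕ.<⇒≱ a<b)

    partition : SetPartition m
    partition = mkPartition (tabulate first)
      (λ x → subst (_≤ x) (sym (lookup-first x)) (walkBack-≤ _ x))
      (λ x → trans (cong (lookup (tabulate first)) (lookup-first x))
                   (trans (lookup-first (first x)) (trans (first-idem x) (sym (lookup-first x)))))
      where
      lookup-first : ∀ x → lookup (tabulate first) x ≡ first x
      lookup-first = Vec.lookup∘tabulate first

    sameBlock⇒first : ∀ {a b} → SameBlock partition a b → first a ≡ first b
    sameBlock⇒first {a} {b} e = trans (sym (Vec.lookup∘tabulate first a)) (trans e (Vec.lookup∘tabulate first b))

    first⇒sameBlock : ∀ {a b} → first a ≡ first b → SameBlock partition a b
    first⇒sameBlock {a} {b} e = trans (Vec.lookup∘tabulate first a) (trans e (sym (Vec.lookup∘tabulate first b)))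

    ∋⇒consecutive : ∀ {a b} → v ∋ a ↦ b → Consecutive partition a b
    ∋⇒consecutive {a} {b} ab = forward ab , first⇒sameBlock (sym (first-∋ ab)) , λ x a<x x<b ax →
      let (c , ac , c≤x) = arc-within (suc (toℕ x)) (ℕ.n<1+n _) (sameBlock⇒first ax) a<x in
      contradiction (subst (_≤ x) (just-injective (trans (sym ac) ab)) c≤x) (ℕ.<⇒≱ x<b)

    consecutive⇒∋ : ∀ {a b} → Consecutive partition a b → v ∋ a ↦ b
    consecutive⇒∋ {a} {b} (a<b , ab , between) with arc-within (suc (toℕ b)) (ℕ.n<1+n _) (sameBlock⇒first ab) a<b
    ... | c , ac , c≤b with <-cmp c b
    ...   | tri≈ _ refl _ = ac
    ...   | tri< c<b _ _ = contradiction (first⇒sameBlock (sym (first-∋ ac))) (between c (forward ac) c<b)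
    ...   | tri> _ _ b<c = contradiction c≤b (ℕ.<⇒≱ b<c)

  toDiagram : ∀ {m} → SetPartition m → StrictDiagram m
  toDiagram = FromPartition.diagram

  toPartition : ∀ {m} → StrictDiagram m → SetPartition m
  toPartition (strictDiagram v strict) = ToPartition.partition v (IsArcDiagram-recompute _<?_ strict)

  toDiagram∘toPartition : ∀ {m} (D : StrictDiagram m) → toDiagram (toPartition D) ≡ D
  toDiagram∘toPartition (strictDiagram v strict) =
    StrictDiagram-ext (lookup-ext λ a → trans (Vec.lookup∘tabulate successor a) (successor≡ a (lookup v a) refl))
    where
    open ToPartition v (IsArcDiagram-recompute _<?_ strict)
    open FromPartition partition using (successor; successor-just; consecutive⇒successor)
    successor≡ : ∀ a mb → lookup v a ≡ mb → successor a ≡ mb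
    successor≡ a (just b) ab = consecutive⇒successor (∋⇒consecutive ab)
    successor≡ a nothing  a↦ = no-successor (successor a) refl
      where
      no-successor : ∀ mb → successor a ≡ mb → successor a ≡ nothing
      no-successor nothing  e = e
      no-successor (just b) e = case trans (sym a↦) (consecutive⇒∋ (successor-just e)) of λ ()

  toPartition∘toDiagram : ∀ {m} (π : SetPartition m) → toPartition (toDiagram π) ≡ π
  toPartition∘toDiagram {m} π@(mkPartition r rep≤ repIdem) =
    SetPartition-ext (lookup-ext λ x → trans (Vec.lookup∘tabulate first x) (walkBack≡rep (suc (toℕ x)) x (ℕ.n<1+n _)))
    where
    open FromPartition π using (successors; successors-strict; ∋⇒consecutive; consecutive⇒∋; consecutive-before)
    open ToPartition successors (IsArcDiagram-recompute _<?_ successors-strict)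
      using (HasPredecessor; predecessor?; walkBack; first)
    R : Fin m → Fin m
    R = lookup r
    rep-initial : ∀ x → ¬ HasPredecessor x → R x ≡ x
    rep-initial x ¬yx with <-cmp (R x) x
    ... | tri≈ _ Rx≡x _ = Rx≡x
    ... | tri> _ _ x<Rx = contradiction (recompute (R x ≤? x) (rep≤ x)) (ℕ.<⇒≱ x<Rx)
    ... | tri< Rx<x _ _ =
      let (y , yx) = consecutive-before (suc (toℕ x)) (ℕ.≤-trans (ℕ.n<1+n _) (ℕ.m≤n+m _ (toℕ (R x))))
                       (recompute (R (R x) ≟ R x) (repIdem x)) Rx<x in
      contradiction (y , consecutive⇒∋ yx) ¬yx
    walkBack≡rep : ∀ s x → toℕ x ℕ.< s → walkBack s x ≡ R x
    walkBack≡rep (suc s) x x<s with predecessor? x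
    ... | yes (y , yx) = let (y<x , same , _) = ∋⇒consecutive yx in
      trans (walkBack≡rep s y (ℕ.<-≤-trans y<x (ℕ.≤-pred x<s))) same
    ... | no ¬yx = sym (rep-initial x ¬yx)

module PartitionCrossings where

  open ArcDiagrams
  open StandardRepresentation
  open import Data.Nat using (ℕ)
  open import Data.Fin using (Fin; _≤_; _<_)
  open import Data.Product using (_×_; _,_)
  open import Data.Sum using (_⊎_; inj₁; inj₂)
  open import Data.Refinement using (Refinement-syntax; _,_; value-injective)
  open import Data.Irrelevant using ([_])
  open import Function using (_∘_)
  open import Function.Bundles using (_↔_; mk↔ₛ′)
  open import Relation.Nullary using (¬_)
  open import Relation.Binary.PropositionalEquality

  EnhancedPair : ∀ {m} → PartialMap m → Fin m → Fin m → Set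
  EnhancedPair v a b = v ∋ a ↦ b ⊎ (a ≡ b × ¬ Covered v a)

  NoCrossingPartition-ext : ∀ {m Cross} {p q : NoCrossingPartition m Cross} →
    NoCrossingPartition.partition p ≡ NoCrossingPartition.partition q → p ≡ q
  NoCrossingPartition-ext {p = _ , _} {_ , _} refl = refl

  module _ {m} {Cross : SetPartition m → Set} {Bad : PartialMap m → Set}
           (to : ∀ π → Cross π → Bad (arcs (toDiagram π)))
           (from : ∀ π → Bad (arcs (toDiagram π)) → Cross π) where

    NoCrossingPartition↔ : NoCrossingPartition m Cross ↔ [ D ∈ StrictDiagram m ∣ ¬ Bad (arcs D) ]
    NoCrossingPartition↔ = mk↔ₛ′ f g f∘g g∘f
      where
      f : NoCrossingPartition m Cross → [ D ∈ StrictDiagram m ∣ ¬ Bad (arcs D) ]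
      f (π , noCross) = toDiagram π , [ noCross ∘ from π ]
      g : [ D ∈ StrictDiagram m ∣ ¬ Bad (arcs D) ] → NoCrossingPartition m Cross
      g (D , [ noBad ]) = toPartition D , λ c → noBad (subst (Bad ∘ arcs) (toDiagram∘toPartition D) (to _ c))
      f∘g : ∀ D → f (g D) ≡ D
      f∘g (D , _) = value-injective (toDiagram∘toPartition D)
      g∘f : ∀ p → g (f p) ≡ p
      g∘f (π , _) = NoCrossingPartition-ext (toPartition∘toDiagram π)

  NoClassicalDiagram : ℕ → ℕ → Set
  NoClassicalDiagram k m = [ D ∈ StrictDiagram m ∣ ¬ Crossing _<_ (arcs D ∋_↦_) k ]

  NoEnhancedDiagram : ℕ → ℕ → Set
  NoEnhancedDiagram k m = [ D ∈ StrictDiagram m ∣ ¬ Crossing _≤_ (EnhancedPair (arcs D)) k ]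

  module _ (k : ℕ) {m : ℕ} where

    NoClassical↔ : NoClassical k m ↔ NoClassicalDiagram k m
    NoClassical↔ = NoCrossingPartition↔
      (λ π → Crossing-mapPairs (FromPartition.consecutive⇒∋ π) ∘ fromΣ)
      (λ π → toΣ ∘ Crossing-mapPairs (FromPartition.∋⇒consecutive π))

    NoEnhanced↔ : NoEnhanced k m ↔ NoEnhancedDiagram k m
    NoEnhanced↔ = NoCrossingPartition↔
      (λ π → Crossing-mapPairs (to-pair π) ∘ fromΣ)
      (λ π → toΣ ∘ Crossing-mapPairs (from-pair π))
      where
      to-pair : ∀ π {a b} → Consecutive π a b ⊎ (a ≡ b × Singleton π a) → EnhancedPair (arcs (toDiagram π)) a b
      to-pair π (inj₁ ab)              = inj₁ (FromPartition.consecutive⇒∋ π ab)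
      to-pair π (inj₂ (a≡b , single)) = inj₂ (a≡b , FromPartition.singleton⇒uncovered π single)
      from-pair : ∀ π {a b} → EnhancedPair (arcs (toDiagram π)) a b → Consecutive π a b ⊎ (a ≡ b × Singleton π a)
      from-pair π (inj₁ ab)                 = inj₁ (FromPartition.∋⇒consecutive π ab)
      from-pair π (inj₂ (a≡b , uncovered)) = inj₂ (a≡b , FromPartition.uncovered⇒singleton π uncovered)

module Shift where

  open ArcDiagrams
  open PointDeletion using (punchIn-mono-<; punchIn-cancel-<; PunchInView; at-x; punchIn⁺; punchInView)
  open WeakConfigurations
  open StandardRepresentation using (strictDiagram; StrictDiagram-ext)
  open PartitionCrossings using (NoClassicalDiagram)
  open import Data.Nat.Base as ℕ using (ℕ; suc; s≤s)
  import Data.Nat.Properties as ℕ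
  open import Data.Bool using (false)
  open import Data.Fin using (Fin; zero; suc; toℕ; fromℕ; punchIn; _≤_; _<_)
  open import Data.Fin.Properties using (punchIn-injective; toℕ-fromℕ; toℕ≤pred[n]; suc-injective; _<?_)
  import Data.Vec as Vec
  open import Data.Vec using (lookup; tabulate; insertAt; replicate)
  import Data.Vec.Properties as Vec
  open import Data.Maybe using (Maybe; just; nothing; map; _>>=_)
  open import Data.Maybe.Properties using (just-injective)
  open import Data.Product using (Σ; _×_; _,_)
  open import Data.Refinement using (_,_; value-injective)
  open import Data.Irrelevant using ([_])
  open import Function using (_∘_; case_of_)
  open import Function.Bundles using (_↔_; mk↔ₛ′)
  open import Relation.Nullary using (contradiction)
  open import Relation.Binary.PropositionalEquality

  toℕ-punchIn-fromℕ : ∀ {m} (x : Fin m) → toℕ (punchIn (fromℕ m) x) ≡ toℕ x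
  toℕ-punchIn-fromℕ zero    = refl
  toℕ-punchIn-fromℕ (suc x) = cong suc (toℕ-punchIn-fromℕ x)

  module _ {n : ℕ} where

    last : Fin (suc n)
    last = fromℕ n

    ≤⇒punchIn-last<suc : ∀ {x y : Fin n} → x ≤ y → punchIn last x < suc y
    ≤⇒punchIn-last<suc {x} x≤y = s≤s (subst (ℕ._≤ _) (sym (toℕ-punchIn-fromℕ x)) x≤y)

    punchIn-last<suc⇒≤ : ∀ {x y : Fin n} → punchIn last x < suc y → x ≤ y
    punchIn-last<suc⇒≤ {x} (s≤s x<y) = subst (ℕ._≤ _) (toℕ-punchIn-fromℕ x) x<y

    unsuc : Fin (suc n) → Maybe (Fin n)
    unsuc zero    = nothing
    unsuc (suc y) = just y

    -- An arc a < b on [n + 1] becomes a ≤ b - 1 on [n]: no arc leaves last = n or enters 0.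
    shiftDown : PartialMap (suc n) → PartialMap n
    shiftDown v = tabulate λ x → lookup v (punchIn last x) >>= unsuc

    shiftUp : PartialMap n → PartialMap (suc n)
    shiftUp w = insertAt (Vec.map (map suc) w) last nothing

    lookup-shiftDown : ∀ v x → lookup (shiftDown v) x ≡ (lookup v (punchIn last x) >>= unsuc)
    lookup-shiftDown v = Vec.lookup∘tabulate _

    lookup-shiftUp-last : ∀ w → lookup (shiftUp w) last ≡ nothing
    lookup-shiftUp-last w = Vec.insertAt-lookup _ last nothing

    lookup-shiftUp : ∀ w x → lookup (shiftUp w) (punchIn last x) ≡ map suc (lookup w x)
    lookup-shiftUp w x = trans (Vec.insertAt-punchIn _ last nothing x) (Vec.lookup-map x _ w)

    shiftDown⁻ : ∀ v {x y} → shiftDown v ∋ x ↦ y → v ∋ punchIn last x ↦ suc y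
    shiftDown⁻ v {x} e with lookup v (punchIn last x) | lookup-shiftDown v x
    ... | nothing      | e′ = case trans (sym e) e′ of λ ()
    ... | just zero    | e′ = case trans (sym e) e′ of λ ()
    ... | just (suc z) | e′ = cong (just ∘ suc) (just-injective (trans (sym e′) e))

    shiftUp⁻ : ∀ w {a b} → shiftUp w ∋ a ↦ b →
      Σ (Fin n) λ x → Σ (Fin n) λ y → a ≡ punchIn last x × b ≡ suc y × w ∋ x ↦ y
    shiftUp⁻ w {a} e with punchInView last a
    ... | at-x = case trans (sym e) (lookup-shiftUp-last w) of λ ()
    ... | punchIn⁺ x with lookup w x in wx | lookup-shiftUp w x
    ...   | nothing | e′ = case trans (sym e) e′ of λ ()
    ...   | just y  | e′ = x , y , refl , just-injective (trans (sym e) e′) , wx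

    shiftDown-shiftUp : ∀ w → shiftDown (shiftUp w) ≡ w
    shiftDown-shiftUp w = lookup-ext λ x → begin
      lookup (shiftDown (shiftUp w)) x                 ≡⟨ lookup-shiftDown (shiftUp w) x ⟩
      (lookup (shiftUp w) (punchIn last x) >>= unsuc)  ≡⟨ cong (_>>= unsuc) (lookup-shiftUp w x) ⟩
      (map suc (lookup w x) >>= unsuc)                 ≡⟨ unsuc∘suc (lookup w x) ⟩
      lookup w x                                       ∎
      where
      open ≡-Reasoning
      unsuc∘suc : ∀ my → (map suc my >>= unsuc) ≡ my
      unsuc∘suc nothing  = refl
      unsuc∘suc (just _) = refl

    shiftUp-shiftDown : ∀ v → IsArcDiagram _<_ v → shiftUp (shiftDown v) ≡ v
    shiftUp-shiftDown v strict = lookup-ext λ a → reshift a (punchInView last a)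
      where
      open IsArcDiagram strict
      reshift : ∀ a → PunchInView last a → lookup (shiftUp (shiftDown v)) a ≡ lookup v a
      reshift _ at-x with lookup v last in e
      ... | nothing = lookup-shiftUp-last (shiftDown v)
      ... | just b  = contradiction (toℕ≤pred[n] b) (ℕ.<⇒≱ (subst (ℕ._< toℕ b) (toℕ-fromℕ n) (forward e)))
      reshift _ (punchIn⁺ x) with lookup v (punchIn last x) in e | lookup-shiftDown v x
      ... | nothing      | e′ = trans (lookup-shiftUp (shiftDown v) x) (cong (map suc) e′)
      ... | just zero    | _  = contradiction (forward e) ℕ.n≮0
      ... | just (suc y) | e′ = trans (lookup-shiftUp (shiftDown v) x) (cong (map suc) e′)

    shiftDown-isWeak : ∀ {v} → IsArcDiagram _<_ v → IsArcDiagram _≤_ (shiftDown v)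
    shiftDown-isWeak {v} strict = record
      { forward   = λ e → punchIn-last<suc⇒≤ (forward (shiftDown⁻ v e))
      ; injective = λ e e′ → punchIn-injective last _ _ (injective (shiftDown⁻ v e) (shiftDown⁻ v e′))
      }
      where open IsArcDiagram strict

    shiftUp-isStrict : ∀ {w} → IsArcDiagram _≤_ w → IsArcDiagram _<_ (shiftUp w)
    shiftUp-isStrict {w} weak = record { forward = forward′ ; injective = injective′ }
      where
      open IsArcDiagram weak
      forward′ : ∀ {a b} → shiftUp w ∋ a ↦ b → a < b
      forward′ e with shiftUp⁻ w e
      ... | x , y , refl , refl , e′ = ≤⇒punchIn-last<suc (forward e′)
      injective′ : ∀ {a a′ b} → shiftUp w ∋ a ↦ b → shiftUp w ∋ a′ ↦ b → a ≡ a′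
      injective′ e e′ with shiftUp⁻ w e | shiftUp⁻ w e′
      ... | x , y , refl , refl , f | x′ , y′ , refl , y≡y′ , f′ =
        cong (punchIn last) (injective f (subst (w ∋ x′ ↦_) (sym (suc-injective y≡y′)) f′))

    shiftDown-crossing : ∀ {k} v → Crossing _≤_ (shiftDown v ∋_↦_) k → Crossing _<_ (v ∋_↦_) k
    shiftDown-crossing v = Crossing-image (punchIn last) suc
      (punchIn-mono-< last) s≤s ≤⇒punchIn-last<suc (shiftDown⁻ v)

    shiftUp-crossing : ∀ {k} w → Crossing _<_ (shiftUp w ∋_↦_) k → Crossing _≤_ (w ∋_↦_) k
    shiftUp-crossing w = Crossing-preimage (punchIn last) suc
      (punchIn-cancel-< last) ℕ.≤-pred punchIn-last<suc⇒≤ (shiftUp⁻ w)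

    shift : ∀ k → NoClassicalDiagram k (suc n) ↔ WeakNoncrossing k (replicate n false)
    shift k = mk↔ₛ′ f g f∘g g∘f
      where
      f : NoClassicalDiagram k (suc n) → WeakNoncrossing k (replicate n false)
      f (strictDiagram v strict , [ noCross ]) =
        weakNoncrossing (shiftDown v) (shiftDown-isWeak strict) (noCross ∘ shiftDown-crossing v)
          λ x x-marked → case trans (sym (Vec.lookup-replicate x false)) x-marked of λ ()
      g : WeakNoncrossing k (replicate n false) → NoClassicalDiagram k (suc n)
      g (weakNoncrossing w weak noCross _) =
        strictDiagram (shiftUp w) (shiftUp-isStrict weak) , [ noCross ∘ shiftUp-crossing w ]
      f∘g : ∀ c → f (g c) ≡ c
      f∘g (weakNoncrossing w _ _ _) = WeakNoncrossing-ext (shiftDown-shiftUp w)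
      g∘f : ∀ D → g (f D) ≡ D
      g∘f (strictDiagram v strict , _) =
        value-injective (StrictDiagram-ext (shiftUp-shiftDown v (IsArcDiagram-recompute _<?_ strict)))

module Loops where

  open ArcDiagrams
  open WeakConfigurations
  open StandardRepresentation using (strictDiagram; StrictDiagram-ext)
  open PartitionCrossings using (EnhancedPair; NoEnhancedDiagram)
  open import Data.Nat using (ℕ)
  import Data.Nat.Properties as ℕ
  open import Data.Bool using (true)
  open import Data.Fin using (Fin; _≤_; _<_; _≟_)
  open import Data.Fin.Properties using (_<?_; _≤?_; ≤∧≢⇒<; <⇒≢)
  open import Data.Vec using (lookup; tabulate; replicate)
  import Data.Vec.Properties as Vec
  open import Data.Maybe using (Maybe; just; nothing; _>>=_)
  open import Data.Maybe.Properties using (just-injective)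
  open import Data.Product using (_×_; _,_)
  open import Data.Sum using (inj₁; inj₂)
  open import Data.Refinement using (_,_; value-injective)
  open import Data.Irrelevant using ([_])
  open import Function using (_∘_; case_of_)
  open import Function.Bundles using (_↔_; mk↔ₛ′)
  open import Relation.Nullary using (¬_; Dec; yes; no; contradiction)
  open import Relation.Nullary.Decidable using (recompute)
  open import Relation.Binary.PropositionalEquality

  module _ {m : ℕ} where

    loopIfUncovered : (v : PartialMap m) (x : Fin m) → Dec (Covered v x) → Maybe (Fin m)
    loopIfUncovered v x (yes _) = lookup v x
    loopIfUncovered v x (no _)  = just x

    addLoops : PartialMap m → PartialMap m
    addLoops v = tabulate λ x → loopIfUncovered v x (covered? v x)

    dropLoop : Fin m → Fin m → Maybe (Fin m)
    dropLoop x y with x ≟ y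
    ... | yes _ = nothing
    ... | no _  = just y

    removeLoops : PartialMap m → PartialMap m
    removeLoops w = tabulate λ x → lookup w x >>= dropLoop x

    lookup-addLoops : ∀ v x → lookup (addLoops v) x ≡ loopIfUncovered v x (covered? v x)
    lookup-addLoops v = Vec.lookup∘tabulate _

    lookup-removeLoops : ∀ w x → lookup (removeLoops w) x ≡ (lookup w x >>= dropLoop x)
    lookup-removeLoops w = Vec.lookup∘tabulate _

    dropLoop-≢ : ∀ {x y} → x ≢ y → dropLoop x y ≡ just y
    dropLoop-≢ {x} {y} x≢y with x ≟ y
    ... | yes x≡y = contradiction x≡y x≢y
    ... | no _    = refl

    dropLoop-refl : ∀ x → dropLoop x x ≡ nothing
    dropLoop-refl x with x ≟ x
    ... | yes _  = refl
    ... | no x≢x = contradiction refl x≢x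

    addLoops⁻ : ∀ v {x y} → addLoops v ∋ x ↦ y → EnhancedPair v x y
    addLoops⁻ v {x} e = loop⁻ (covered? v x) (trans (sym (lookup-addLoops v x)) e)
      where
      loop⁻ : ∀ {y} d → loopIfUncovered v x d ≡ just y → EnhancedPair v x y
      loop⁻ (yes _)        e′   = inj₁ e′
      loop⁻ (no uncovered) refl = inj₂ (refl , uncovered)

    addLoops⁺ : ∀ v {x y} → EnhancedPair v x y → addLoops v ∋ x ↦ y
    addLoops⁺ v {x} p = trans (lookup-addLoops v x) (loop⁺ (covered? v x) p)
      where
      loop⁺ : ∀ {y} d → EnhancedPair v x y → loopIfUncovered v x d ≡ just y
      loop⁺ (yes _)         (inj₁ e)                 = e
      loop⁺ (yes covered)   (inj₂ (refl , uncovered)) = contradiction covered uncovered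
      loop⁺ (no uncovered)  (inj₁ e)                 = contradiction (inj₁ (_ , e)) uncovered
      loop⁺ (no _)          (inj₂ (refl , _))        = refl

    addLoops-covers : ∀ v x → Covered (addLoops v) x
    addLoops-covers v x with covered? v x
    ... | yes (inj₁ (y , e)) = inj₁ (y , addLoops⁺ v (inj₁ e))
    ... | yes (inj₂ (y , e)) = inj₂ (y , addLoops⁺ v (inj₁ e))
    ... | no uncovered       = inj₁ (x , addLoops⁺ v (inj₂ (refl , uncovered)))

    removeLoops⁻ : ∀ w {x y} → removeLoops w ∋ x ↦ y → w ∋ x ↦ y × x ≢ y
    removeLoops⁻ w {x} e with lookup w x | lookup-removeLoops w x
    ... | nothing | e′ = case trans (sym e) e′ of λ ()
    ... | just z  | e′ with x ≟ z
    ...   | yes _   = case trans (sym e) e′ of λ ()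
    ...   | no x≢z  = let z≡y = just-injective (trans (sym e′) e) in cong just z≡y , subst (x ≢_) z≡y x≢z

    removeLoops⁺ : ∀ w {x y} → w ∋ x ↦ y → x ≢ y → removeLoops w ∋ x ↦ y
    removeLoops⁺ w {x} e x≢y = trans (lookup-removeLoops w x) (trans (cong (_>>= dropLoop x) e) (dropLoop-≢ x≢y))

    addLoops-isWeak : ∀ {v} → IsArcDiagram _<_ v → IsArcDiagram _≤_ (addLoops v)
    addLoops-isWeak {v} strict = record { forward = forward′ ; injective = injective′ }
      where
      open IsArcDiagram strict
      forward′ : ∀ {a b} → addLoops v ∋ a ↦ b → a ≤ b
      forward′ e with addLoops⁻ v e
      ... | inj₁ ab         = ℕ.<⇒≤ (forward ab)
      ... | inj₂ (refl , _) = ℕ.≤-refl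
      injective′ : ∀ {a a′ b} → addLoops v ∋ a ↦ b → addLoops v ∋ a′ ↦ b → a ≡ a′
      injective′ e e′ with addLoops⁻ v e | addLoops⁻ v e′
      ... | inj₁ ab                 | inj₁ a′b                 = injective ab a′b
      ... | inj₁ ab                 | inj₂ (refl , uncovered) = contradiction (inj₂ (_ , ab)) uncovered
      ... | inj₂ (refl , uncovered) | inj₁ a′b                 = contradiction (inj₂ (_ , a′b)) uncovered
      ... | inj₂ (refl , _)         | inj₂ (refl , _)         = refl

    removeLoops-isStrict : ∀ {w} → IsArcDiagram _≤_ w → IsArcDiagram _<_ (removeLoops w)
    removeLoops-isStrict {w} weak = record
      { forward   = λ e → let (ab , a≢b) = removeLoops⁻ w e in ≤∧≢⇒< (forward ab) a≢b
      ; injective = λ e e′ → let (ab , _) = removeLoops⁻ w e ; (a′b , _) = removeLoops⁻ w e′ in injective ab a′b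
      }
      where open IsArcDiagram weak

    removeLoops-addLoops : ∀ v → IsArcDiagram _<_ v → removeLoops (addLoops v) ≡ v
    removeLoops-addLoops v strict = lookup-ext λ x → begin
      lookup (removeLoops (addLoops v)) x                    ≡⟨ lookup-removeLoops (addLoops v) x ⟩
      (lookup (addLoops v) x >>= dropLoop x)                 ≡⟨ cong (_>>= dropLoop x) (lookup-addLoops v x) ⟩
      (loopIfUncovered v x (covered? v x) >>= dropLoop x)    ≡⟨ unloop x (covered? v x) ⟩
      lookup v x                                             ∎
      where
      open ≡-Reasoning
      open IsArcDiagram strict
      keep : ∀ x → (lookup v x >>= dropLoop x) ≡ lookup v x
      keep x with lookup v x in e
      ... | nothing = refl
      ... | just y  = dropLoop-≢ (<⇒≢ (forward e))
      unloop : ∀ x d → (loopIfUncovered v x d >>= dropLoop x) ≡ lookup v x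
      unloop x (yes _)        = keep x
      unloop x (no uncovered) = trans (dropLoop-refl x) (sym (uncovered⇒nothing v x uncovered))

    addLoops-removeLoops : ∀ w → IsArcDiagram _≤_ w → (∀ x → Covered w x) → addLoops (removeLoops w) ≡ w
    addLoops-removeLoops w weak covers = lookup-ext λ x →
      trans (lookup-addLoops (removeLoops w) x) (restore x (covered? (removeLoops w) x))
      where
      open IsArcDiagram weak
      loop-uncovered : ∀ {x} → w ∋ x ↦ x → ¬ Covered (removeLoops w) x
      loop-uncovered xx (inj₁ (_ , e)) = let (xy , x≢y) = removeLoops⁻ w e in x≢y (just-injective (trans (sym xx) xy))
      loop-uncovered xx (inj₂ (_ , e)) = let (zx , z≢x) = removeLoops⁻ w e in z≢x (injective zx xx)
      entered : ∀ {x} → lookup w x ≡ nothing → Covered (removeLoops w) x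
      entered {x} e with covers x
      ... | inj₁ (_ , xy) = case trans (sym e) xy of λ ()
      ... | inj₂ (z , zx) = inj₂ (z , removeLoops⁺ w zx λ { refl → case trans (sym e) zx of λ () })
      restore : ∀ x d → loopIfUncovered (removeLoops w) x d ≡ lookup w x
      restore x (yes covered) with lookup w x in e
      ... | nothing = trans (lookup-removeLoops w x) (cong (_>>= dropLoop x) e)
      ... | just y with x ≟ y
      ...   | yes refl = contradiction covered (loop-uncovered e)
      ...   | no x≢y   = removeLoops⁺ w e x≢y
      restore x (no uncovered) with lookup w x in e
      ... | nothing = contradiction (entered e) uncovered
      ... | just y with x ≟ y
      ...   | yes refl = refl
      ...   | no x≢y   = contradiction (inj₁ (y , removeLoops⁺ w e x≢y)) uncovered

  loops : ∀ k {m} → NoEnhancedDiagram k m ↔ WeakNoncrossing k (replicate m true)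
  loops k {m} = mk↔ₛ′ f g f∘g g∘f
    where
    all-covered : ∀ {w} → .(∀ x → lookup (replicate m true) x ≡ true → Covered w x) → ∀ x → Covered w x
    all-covered {w} covers x = recompute (covered? w x) (covers x (Vec.lookup-replicate x true))
    f : NoEnhancedDiagram k m → WeakNoncrossing k (replicate m true)
    f (strictDiagram v strict , [ noCross ]) =
      weakNoncrossing (addLoops v) (addLoops-isWeak strict) (noCross ∘ Crossing-mapPairs (addLoops⁻ v))
        λ x _ → addLoops-covers v x
    g : WeakNoncrossing k (replicate m true) → NoEnhancedDiagram k m
    g (weakNoncrossing w weak noCross covers) =
      strictDiagram (removeLoops w) (removeLoops-isStrict weak) ,
      [ noCross ∘ subst (λ u → Crossing _≤_ (u ∋_↦_) k) (addLoops-removeLoops w weak (all-covered {w} covers))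
                ∘ Crossing-mapPairs (addLoops⁺ (removeLoops w)) ]
    f∘g : ∀ c → f (g c) ≡ c
    f∘g (weakNoncrossing w weak _ covers) =
      WeakNoncrossing-ext (addLoops-removeLoops w (IsArcDiagram-recompute _≤?_ weak) (all-covered {w} covers))
    g∘f : ∀ D → g (f D) ≡ D
    g∘f (strictDiagram v strict , _) =
      value-injective (StrictDiagram-ext (removeLoops-addLoops v (IsArcDiagram-recompute _<?_ strict)))

open import Data.Nat using (ℕ; suc; _+_; _*_; _≤_)
open import Data.Nat.Combinatorics using (_C_)
open import Data.List using (map; upTo)
open import Data.Nat.ListAction using (sum)
open import Data.Fin using (Fin)
open import Function.Bundles using (_↔_)
open import Relation.Binary.PropositionalEquality using (_≡_)
open import Data.Bool using (true)
open import Data.Vec using (replicate)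
open import Data.Fin.Permutation using (↔⇒≡)
open import Function.Properties.Inverse using (↔-trans; ↔-sym)
open import Relation.Binary.PropositionalEquality using (trans)
open BinomialSums using (binomialSum; binomialSum-upTo)
open WeakConfigurations using (WeakNoncrossing)
open Counting using (count-unmarked)
open PartitionCrossings using (NoClassical↔; NoEnhanced↔)
open Shift using (shift)
open Loops using (loops)

theorem1 : ∀ (n k : ℕ) → 1 ≤ k →
    (c : ℕ) → NoClassical k (suc n) ↔ Fin c →
    (e : ℕ → ℕ) → (∀ i → i ≤ n → NoEnhanced k i ↔ Fin (e i)) →
    c ≡ sum (map (λ i → (n C i) * e i) (upTo (suc n)))
theorem1 n k _ c classical e enhanced =
  trans (↔⇒≡ (↔-trans (↔-sym classical) counted)) (binomialSum-upTo e n)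
  where
  fully-marked : ∀ i → i ≤ n → WeakNoncrossing k (replicate i true) ↔ Fin (e i)
  fully-marked i i≤n = ↔-trans (↔-sym (↔-trans (NoEnhanced↔ k) (loops k))) (enhanced i i≤n)
  counted : NoClassical k (suc n) ↔ Fin (binomialSum e (suc n) n 0)
  counted = ↔-trans (NoClassical↔ k) (↔-trans (shift k) (count-unmarked k n e fully-marked))
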